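{- Let $D>1$ be a squarefree integer, let $\sqrt D=[u_0,u_1,u_2,\dots]$ be its continued fraction expansion with convergents $p_i/q_i=[u_0,\dots,u_i]$, and put $\alpha_i=p_i+q_i\sqrt D$, $N(\alpha_i)=p_i^2-Dq_i^2$. Then for every $i\ge0$, $$\frac{2\sqrt D}{u_{i+1}+2.5}<|N(\alpha_i)|<\frac{2\sqrt D}{u_{i+1}-0.5}.$$
   Context: The convergents satisfy $p_0=u_0$, $p_1=u_1u_0+1$, $q_0=1$, $q_1=u_1$, $p_{i+1}=u_{i+1}p_i+p_{i-1}$, $q_{i+1}=u_{i+1}q_i+q_{i-1}$. -}

module Defs where

open import Data.Nat as ℕ using (ℕ; zero; suc)
open import Data.Nat.Divisibility using (_∣_)
open import Data.Integer as ℤ using (ℤ; +_)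
open import Data.Rational as ℚ using (ℚ; 0ℚ; 1ℚ; _/_)
open import Data.Product using (_×_; _,_; proj₁; proj₂; Σ)
open import Data.Sum using (_⊎_)
open import Relation.Binary.PropositionalEquality using (_≡_)

Squarefree : ℕ → Set
Squarefree D = ∀ k → k ℕ.* k ∣ D → k ≡ 1

-- Elements a + b√D of ℚ(√D), represented by the pair (a , b).
QD : Set
QD = ℚ × ℚ

module _ (D : ℕ) where
  Dℚ : ℚ
  Dℚ = + D / 1

  mulD : QD → QD → QD
  mulD (a , b) (c , d) = (a ℚ.* c ℚ.+ Dℚ ℚ.* (b ℚ.* d)) , (a ℚ.* d ℚ.+ b ℚ.* c)

  PosD : QD → Set
  PosD (a , b) =
      (0ℚ ℚ.≤ a × 0ℚ ℚ.≤ b × (0ℚ ℚ.< a ⊎ 0ℚ ℚ.< b))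
    ⊎ (0ℚ ℚ.< a × b ℚ.< 0ℚ × Dℚ ℚ.* (b ℚ.* b) ℚ.< a ℚ.* a)
    ⊎ (a ℚ.< 0ℚ × 0ℚ ℚ.< b × a ℚ.* a ℚ.< Dℚ ℚ.* (b ℚ.* b))

  NonNegD : QD → Set
  NonNegD x = PosD x ⊎ (proj₁ x ≡ 0ℚ × proj₂ x ≡ 0ℚ)

  subD : QD → QD → QD
  subD (a , b) (c , d) = (a ℚ.- c) , (b ℚ.- d)

  _<D_ : QD → QD → Set
  x <D y = PosD (subD y x)

  _≤D_ : QD → QD → Set
  x ≤D y = NonNegD (subD y x)

  fromℕD : ℕ → QD
  fromℕD n = (+ n / 1) , 0ℚ

  IsFloor : QD → ℕ → Set
  IsFloor x n = fromℕD n ≤D x × x <D fromℕD (suc n)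

  sqrtD : QD
  sqrtD = 0ℚ , 1ℚ

  IsCFExpansionOfSqrt : (ℕ → ℕ) → (ℕ → QD) → Set
  IsCFExpansionOfSqrt u x =
      x 0 ≡ sqrtD
    × (∀ i → IsFloor (x i) (u i))
    × (∀ i → mulD (x (suc i)) (subD (x i) (fromℕD (u i))) ≡ (1ℚ , 0ℚ))

-- Convergents: pq u i = ((p_i , p_{i-1}) , (q_i , q_{i-1})) with
-- p_{-1} = 1, p_{-2} = 0, q_{-1} = 0, q_{-2} = 1, so p_0 = u_0, q_0 = 1,
-- p_1 = u_1 u_0 + 1, q_1 = u_1, p_{i+1} = u_{i+1} p_i + p_{i-1}, etc.
pq : (ℕ → ℕ) → ℕ → (ℤ × ℤ) × (ℤ × ℤ)
pq u zero = ((+ u 0) , + 1) , (+ 1 , + 0)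
pq u (suc i) with pq u i
... | (p , p') , (q , q') =
  ((+ u (suc i)) ℤ.* p ℤ.+ p' , p) , ((+ u (suc i)) ℤ.* q ℤ.+ q' , q)

p : (ℕ → ℕ) → ℕ → ℤ
p u i = proj₁ (proj₁ (pq u i))

q : (ℕ → ℕ) → ℕ → ℤ
q u i = proj₁ (proj₂ (pq u i))

Nα : ℕ → (ℕ → ℕ) → ℕ → ℤ
Nα D u i = p u i ℤ.* p u i ℤ.- (+ D) ℤ.* (q u i ℤ.* q u i)

absNα : ℕ → (ℕ → ℕ) → ℕ → QD
absNα D u i = (+ ℤ.∣ Nα D u i ∣ / 1) , 0ℚ

-- Write the complete quotients of √D as x_j = (P_j + √D)/Q_j with integers P_j, Q_j, so
-- that u_j = ⌊x_j⌋ and P_{j+1} = u_j Q_j − P_j, Q_{j+1} Q_j = D − P_{j+1}².  The classical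
-- identity p_i² − D q_i² = (−1)^{i+1} Q_{i+1} gives |N(α_i)| = Q_{i+1}.  Comparisons with √D
-- are made over ℤ through w = ⌊√D⌋ (an integer m is below √D iff m ≤ w), and for j ≥ 1 the
-- quotient x_j is reduced: 0 < P_j ≤ w < P_j + Q_j and Q_j − P_j ≤ w.  With P = P_{i+1},
-- Q = Q_{i+1}, u = u_{i+1} the floor gives uQ − P ≤ w < (u+1)Q − P, hence
-- Q(2u+5) ≥ 4(w+1) > 4√D and Q(2u−1) ≤ 4w < 4√D, which are the two claimed inequalities.

module Submission where

open import Defs
open import Data.Nat using (ℕ; suc; _<_)
open import Data.Rational using (0ℚ; _/_; _+_; _-_)
open import Data.Integer using (+_)
open import Data.Product using (_×_; _,_)

open import Data.Nat as ℕ using (zero)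
import Data.Nat.Properties as ℕP
open import Data.Integer as ℤ using (ℤ)
import Data.Integer.Properties as ℤP
open import Data.Integer.Tactic.RingSolver using (solve-∀; solve)
open import Data.Rational as ℚ using (ℚ; 1ℚ)
import Data.Rational.Properties as ℚP
open import Data.Rational.Unnormalised as ℚᵘ using (mkℚᵘ; *≡*; *≤*; *<*)
import Data.Rational.Unnormalised.Properties as ℚᵘP
open import Data.Product using (proj₁; proj₂; map₂)
open import Data.Sum as Sum using (_⊎_; inj₁; inj₂)
open import Data.Empty using (⊥-elim)
open import Data.List using (_∷_; [])
open import Level using (0ℓ)
open import Relation.Binary.PropositionalEquality
open import Relation.Nullary using (yes; no; contradiction)
open import Relation.Nullary.Decidable using (dec⇒maybe)
import Tactic.RingSolver as Ring
open import Tactic.RingSolver.Core.AlmostCommutativeRing using (AlmostCommutativeRing; fromCommutativeRing)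

ℚ-ring : AlmostCommutativeRing 0ℓ 0ℓ
ℚ-ring = fromCommutativeRing ℚP.+-*-commutativeRing (λ x → dec⇒maybe (0ℚ ℚP.≟ x))

toℚ : ℤ → ℚ
toℚ z = z / 1

toℚᵘ-toℚ : ∀ z → ℚ.toℚᵘ (toℚ z) ℚᵘ.≃ mkℚᵘ z 0
toℚᵘ-toℚ z = ℚP.toℚᵘ-fromℚᵘ (mkℚᵘ z 0)

toℚ-unique : ∀ {q} z → ℚ.toℚᵘ q ℚᵘ.≃ mkℚᵘ z 0 → q ≡ toℚ z
toℚ-unique z h = ℚP.toℚᵘ-injective (ℚᵘP.≃-trans h (ℚᵘP.≃-sym (toℚᵘ-toℚ z)))

toℚ-+ : ∀ a b → toℚ a ℚ.+ toℚ b ≡ toℚ (a ℤ.+ b)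
toℚ-+ a b = toℚ-unique (a ℤ.+ b) (ℚᵘP.≃-trans (ℚP.toℚᵘ-homo-+ (toℚ a) (toℚ b))
  (ℚᵘP.≃-trans (ℚᵘP.+-cong (toℚᵘ-toℚ a) (toℚᵘ-toℚ b)) (*≡* (cross-multiplied a b))))
  where cross-multiplied : ∀ a b → (a ℤ.* + 1 ℤ.+ b ℤ.* + 1) ℤ.* + 1 ≡ (a ℤ.+ b) ℤ.* (+ 1 ℤ.* + 1)
        cross-multiplied = solve-∀

toℚ-* : ∀ a b → toℚ a ℚ.* toℚ b ≡ toℚ (a ℤ.* b)
toℚ-* a b = toℚ-unique (a ℤ.* b) (ℚᵘP.≃-trans (ℚP.toℚᵘ-homo-* (toℚ a) (toℚ b))
  (ℚᵘP.≃-trans (ℚᵘP.*-cong (toℚᵘ-toℚ a) (toℚᵘ-toℚ b)) (*≡* (cross-multiplied a b))))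
  where cross-multiplied : ∀ a b → (a ℤ.* b) ℤ.* + 1 ≡ (a ℤ.* b) ℤ.* (+ 1 ℤ.* + 1)
        cross-multiplied = solve-∀

toℚ-neg : ∀ a → ℚ.- toℚ a ≡ toℚ (ℤ.- a)
toℚ-neg a = toℚ-unique (ℤ.- a) (ℚᵘP.≃-trans (ℚP.toℚᵘ-homo‿- (toℚ a)) (ℚᵘP.-‿cong (toℚᵘ-toℚ a)))

toℚ-minus : ∀ a b → toℚ a ℚ.- toℚ b ≡ toℚ (a ℤ.- b)
toℚ-minus a b = trans (cong (toℚ a ℚ.+_) (toℚ-neg b)) (toℚ-+ a (ℤ.- b))

toℚ-mono-≤ : ∀ {a b} → a ℤ.≤ b → toℚ a ℚ.≤ toℚ b
toℚ-mono-≤ {a} {b} a≤b = ℚP.toℚᵘ-cancel-≤ (ℚᵘP.≤-respˡ-≃ (ℚᵘP.≃-sym (toℚᵘ-toℚ a))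
  (ℚᵘP.≤-respʳ-≃ (ℚᵘP.≃-sym (toℚᵘ-toℚ b)) (*≤* (ℤP.*-monoʳ-≤-nonNeg (+ 1) a≤b))))

toℚ-cancel-≤ : ∀ {a b} → toℚ a ℚ.≤ toℚ b → a ℤ.≤ b
toℚ-cancel-≤ {a} {b} h with ℚᵘP.≤-respˡ-≃ (toℚᵘ-toℚ a) (ℚᵘP.≤-respʳ-≃ (toℚᵘ-toℚ b) (ℚP.toℚᵘ-mono-≤ h))
... | *≤* a*1≤b*1 = ℤP.*-cancelʳ-≤-pos a b (+ 1) a*1≤b*1

toℚ-mono-< : ∀ {a b} → a ℤ.< b → toℚ a ℚ.< toℚ b
toℚ-mono-< {a} {b} a<b = ℚP.toℚᵘ-cancel-< (ℚᵘP.<-respˡ-≃ (ℚᵘP.≃-sym (toℚᵘ-toℚ a))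
  (ℚᵘP.<-respʳ-≃ (ℚᵘP.≃-sym (toℚᵘ-toℚ b)) (*<* (ℤP.*-monoʳ-<-pos (+ 1) a<b))))

toℚ-cancel-< : ∀ {a b} → toℚ a ℚ.< toℚ b → a ℤ.< b
toℚ-cancel-< {a} {b} h with ℚᵘP.<-respˡ-≃ (toℚᵘ-toℚ a) (ℚᵘP.<-respʳ-≃ (toℚᵘ-toℚ b) (ℚP.toℚᵘ-mono-< h))
... | *<* a*1<b*1 = ℤP.*-cancelʳ-<-nonNeg (+ 1) a*1<b*1

module _ (D : ℕ) where

  PosD-*-pos : ∀ {a b r} → 0ℚ ℚ.< r → PosD D (a , b) → PosD D (a ℚ.* r , b ℚ.* r)
  PosD-*-pos {a} {b} {r} 0<r = λ
    { (inj₁ (0≤a , 0≤b , 0<a⊎0<b)) →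
        inj₁ (nonNeg 0≤a , nonNeg 0≤b , Sum.map pos pos 0<a⊎0<b)
    ; (inj₂ (inj₁ (0<a , b<0 , Db²<a²))) →
        inj₂ (inj₁ (pos 0<a , neg b<0 , subst₂ ℚ._<_ (d*square (Dℚ D) b r) (square a r) (scale (r ℚ.* r) r² Db²<a²)))
    ; (inj₂ (inj₂ (a<0 , 0<b , a²<Db²))) →
        inj₂ (inj₂ (neg a<0 , pos 0<b , subst₂ ℚ._<_ (square a r) (d*square (Dℚ D) b r) (scale (r ℚ.* r) r² a²<Db²))) }
    where
    scale : ∀ {x y} s → 0ℚ ℚ.< s → x ℚ.< y → x ℚ.* s ℚ.< y ℚ.* s
    scale s 0<s = ℚP.*-monoˡ-<-pos s {{ℚ.positive 0<s}}
    pos : ∀ {x} → 0ℚ ℚ.< x → 0ℚ ℚ.< x ℚ.* r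
    pos {x} 0<x = subst (ℚ._< x ℚ.* r) (ℚP.*-zeroˡ r) (scale r 0<r 0<x)
    neg : ∀ {x} → x ℚ.< 0ℚ → x ℚ.* r ℚ.< 0ℚ
    neg {x} x<0 = subst (x ℚ.* r ℚ.<_) (ℚP.*-zeroˡ r) (scale r 0<r x<0)
    nonNeg : ∀ {x} → 0ℚ ℚ.≤ x → 0ℚ ℚ.≤ x ℚ.* r
    nonNeg {x} 0≤x = subst (ℚ._≤ x ℚ.* r) (ℚP.*-zeroˡ r) (ℚP.*-monoʳ-≤-nonNeg r {{ℚ.nonNegative (ℚP.<⇒≤ 0<r)}} 0≤x)
    r² : 0ℚ ℚ.< r ℚ.* r
    r² = pos 0<r
    square : ∀ x s → x ℚ.* x ℚ.* (s ℚ.* s) ≡ (x ℚ.* s) ℚ.* (x ℚ.* s)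
    square = Ring.solve-∀ ℚ-ring
    d*square : ∀ d x s → d ℚ.* (x ℚ.* x) ℚ.* (s ℚ.* s) ≡ d ℚ.* ((x ℚ.* s) ℚ.* (x ℚ.* s))
    d*square = Ring.solve-∀ ℚ-ring

  PosZ : ℤ → ℤ → Set
  PosZ a b =
      (+ 0 ℤ.≤ a × + 0 ℤ.≤ b × (+ 0 ℤ.< a ⊎ + 0 ℤ.< b))
    ⊎ (+ 0 ℤ.< a × b ℤ.< + 0 × + D ℤ.* (b ℤ.* b) ℤ.< a ℤ.* a)
    ⊎ (a ℤ.< + 0 × + 0 ℤ.< b × a ℤ.* a ℤ.< + D ℤ.* (b ℤ.* b))

  private
    toℚ-D*square : ∀ b → Dℚ D ℚ.* (toℚ b ℚ.* toℚ b) ≡ toℚ (+ D ℤ.* (b ℤ.* b))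
    toℚ-D*square b = trans (cong (Dℚ D ℚ.*_) (toℚ-* b b)) (toℚ-* (+ D) (b ℤ.* b))

  PosD⇒PosZ : ∀ {a b} → PosD D (toℚ a , toℚ b) → PosZ a b
  PosD⇒PosZ {a} {b} (inj₁ (0≤a , 0≤b , 0<a⊎0<b)) =
    inj₁ (toℚ-cancel-≤ 0≤a , toℚ-cancel-≤ 0≤b , Sum.map toℚ-cancel-< toℚ-cancel-< 0<a⊎0<b)
  PosD⇒PosZ {a} {b} (inj₂ (inj₁ (0<a , b<0 , Db²<a²))) =
    inj₂ (inj₁ (toℚ-cancel-< 0<a , toℚ-cancel-< b<0 ,
      toℚ-cancel-< (subst₂ ℚ._<_ (toℚ-D*square b) (toℚ-* a a) Db²<a²)))
  PosD⇒PosZ {a} {b} (inj₂ (inj₂ (a<0 , 0<b , a²<Db²))) =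
    inj₂ (inj₂ (toℚ-cancel-< a<0 , toℚ-cancel-< 0<b ,
      toℚ-cancel-< (subst₂ ℚ._<_ (toℚ-* a a) (toℚ-D*square b) a²<Db²)))

  PosZ⇒PosD : ∀ {a b} → PosZ a b → PosD D (toℚ a , toℚ b)
  PosZ⇒PosD {a} {b} (inj₁ (0≤a , 0≤b , 0<a⊎0<b)) =
    inj₁ (toℚ-mono-≤ 0≤a , toℚ-mono-≤ 0≤b , Sum.map toℚ-mono-< toℚ-mono-< 0<a⊎0<b)
  PosZ⇒PosD {a} {b} (inj₂ (inj₁ (0<a , b<0 , Db²<a²))) =
    inj₂ (inj₁ (toℚ-mono-< 0<a , toℚ-mono-< b<0 ,
      subst₂ ℚ._<_ (sym (toℚ-D*square b)) (sym (toℚ-* a a)) (toℚ-mono-< Db²<a²)))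
  PosZ⇒PosD {a} {b} (inj₂ (inj₂ (a<0 , 0<b , a²<Db²))) =
    inj₂ (inj₂ (toℚ-mono-< a<0 , toℚ-mono-< 0<b ,
      subst₂ ℚ._<_ (sym (toℚ-* a a)) (sym (toℚ-D*square b)) (toℚ-mono-< a²<Db²)))

*-mono-≤-nonNeg : ∀ {a b c d} → + 0 ℤ.≤ a → + 0 ℤ.≤ d → a ℤ.≤ b → c ℤ.≤ d → a ℤ.* c ℤ.≤ b ℤ.* d
*-mono-≤-nonNeg {a} {b} {c} {d} 0≤a 0≤d a≤b c≤d = begin
  a ℤ.* c ≤⟨ ℤP.*-monoˡ-≤-nonNeg a {{ℤ.nonNegative 0≤a}} c≤d ⟩
  a ℤ.* d ≤⟨ ℤP.*-monoʳ-≤-nonNeg d {{ℤ.nonNegative 0≤d}} a≤b ⟩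
  b ℤ.* d ∎
  where open ℤP.≤-Reasoning

square-mono-≤ : ∀ {a b} → + 0 ℤ.≤ a → a ℤ.≤ b → a ℤ.* a ℤ.≤ b ℤ.* b
square-mono-≤ 0≤a a≤b = *-mono-≤-nonNeg 0≤a (ℤP.≤-trans 0≤a a≤b) a≤b a≤b

square-pos : ∀ {c} → + 0 ℤ.< c → + 0 ℤ.< c ℤ.* c
square-pos {c} 0<c = subst (ℤ._< c ℤ.* c) (ℤP.*-zeroʳ c) (ℤP.*-monoˡ-<-pos c {{ℤ.positive 0<c}} 0<c)

module _ (D : ℕ) where

  private
    neg-square : ∀ m → ℤ.- m ℤ.* ℤ.- m ≡ m ℤ.* m
    neg-square = solve-∀
    square-* : ∀ c w → (c ℤ.* w) ℤ.* (c ℤ.* w) ≡ (c ℤ.* c) ℤ.* (w ℤ.* w)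
    square-* = solve-∀

  -- In the names below PosZ D (ℤ.- m) c reads m < c√D and PosZ D m (ℤ.- c) reads c√D < m.
  <√D⇒square<D : ∀ {m} → + 0 ℤ.< + D → + 0 ℤ.≤ m → PosZ D (ℤ.- m) (+ 1) → m ℤ.* m ℤ.< + D
  <√D⇒square<D {m} 0<D 0≤m (inj₁ (0≤-m , _)) =
    subst (λ n → n ℤ.* n ℤ.< + D) (sym (ℤP.≤-antisym (ℤP.neg-cancel-≤ {+ 0} {m} 0≤-m) 0≤m)) 0<D
  <√D⇒square<D _ _ (inj₂ (inj₁ (_ , 1<0 , _))) = ⊥-elim (ℤP.+≮0 1<0)
  <√D⇒square<D {m} _ _ (inj₂ (inj₂ (_ , _ , m²<D))) = subst₂ ℤ._<_ (neg-square m) (ℤP.*-identityʳ (+ D)) m²<D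

  √D<⇒D<square : ∀ {m} → PosZ D m (ℤ.- + 1) → + 0 ℤ.< m × + D ℤ.< m ℤ.* m
  √D<⇒D<square (inj₁ (_ , () , _))
  √D<⇒D<square (inj₂ (inj₂ (_ , () , _)))
  √D<⇒D<square {m} (inj₂ (inj₁ (0<m , _ , D<m²))) = 0<m , subst (ℤ._< m ℤ.* m) (ℤP.*-identityʳ (+ D)) D<m²

  record IsFloorSqrt (w : ℤ) : Set where
    field
      0≤w      : + 0 ℤ.≤ w
      w²<D     : w ℤ.* w ℤ.< + D
      D<[1+w]² : + D ℤ.< (+ 1 ℤ.+ w) ℤ.* (+ 1 ℤ.+ w)

  module _ {w : ℤ} (⌊√D⌋≡w : IsFloorSqrt w) where
    open IsFloorSqrt ⌊√D⌋≡w
    open ℤP.≤-Reasoning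

    private
      0≤1+w : + 0 ℤ.≤ + 1 ℤ.+ w
      0≤1+w = ℤP.≤-trans 0≤w (ℤP.i≤suc[i] w)

    1≤⌊√D⌋ : 1 ℕ.< D → + 1 ℤ.≤ w
    1≤⌊√D⌋ 1<D = ℤP.≮⇒≥ λ w<1 → begin-contradiction
      + 1                          <⟨ ℤ.+<+ 1<D ⟩
      + D                          <⟨ D<[1+w]² ⟩
      (+ 1 ℤ.+ w) ℤ.* (+ 1 ℤ.+ w)  ≤⟨ square-mono-≤ 0≤1+w (ℤP.+-monoʳ-≤ (+ 1) (ℤP.i<j⇒i≤pred[j] w<1)) ⟩
      + 1                          ∎

    <√D⇒≤⌊√D⌋ : ∀ {m} → PosZ D (ℤ.- m) (+ 1) → m ℤ.≤ w
    <√D⇒≤⌊√D⌋ {m} m<√D = ℤP.≮⇒≥ λ w<m → begin-contradiction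
      (+ 1 ℤ.+ w) ℤ.* (+ 1 ℤ.+ w)  ≤⟨ square-mono-≤ 0≤1+w (ℤP.i<j⇒suc[i]≤j w<m) ⟩
      m ℤ.* m                      <⟨ <√D⇒square<D 0<D (ℤP.≤-trans 0≤w (ℤP.<⇒≤ w<m)) m<√D ⟩
      + D                          <⟨ D<[1+w]² ⟩
      (+ 1 ℤ.+ w) ℤ.* (+ 1 ℤ.+ w)  ∎
      where
      0<D : + 0 ℤ.< + D
      0<D = ℤP.≤-<-trans (square-mono-≤ ℤP.≤-refl 0≤w) w²<D

    √D<⇒⌊√D⌋< : ∀ {m} → PosZ D m (ℤ.- + 1) → w ℤ.< m
    √D<⇒⌊√D⌋< {m} √D<m with √D<⇒D<square √D<m
    ... | 0<m , D<m² = ℤP.≰⇒> λ m≤w → begin-contradiction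
      m ℤ.* m      ≤⟨ square-mono-≤ (ℤP.<⇒≤ 0<m) m≤w ⟩
      w ℤ.* w      <⟨ w²<D ⟩
      + D          <⟨ D<m² ⟩
      m ℤ.* m      ∎

    ≤*⌊√D⌋⇒<*√D : ∀ {m c} → + 0 ℤ.< c → m ℤ.≤ c ℤ.* w → PosZ D (ℤ.- m) c
    ≤*⌊√D⌋⇒<*√D {m} {c} 0<c m≤cw with m ℤ.≤? + 0
    ... | yes m≤0 = inj₁ (ℤP.neg-mono-≤ m≤0 , ℤP.<⇒≤ 0<c , inj₂ 0<c)
    ... | no m≰0 = inj₂ (inj₂ (ℤP.neg-mono-< 0<m , 0<c , (begin-strict
      ℤ.- m ℤ.* ℤ.- m          ≡⟨ neg-square m ⟩
      m ℤ.* m                  ≤⟨ square-mono-≤ (ℤP.<⇒≤ 0<m) m≤cw ⟩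
      (c ℤ.* w) ℤ.* (c ℤ.* w)  ≡⟨ square-* c w ⟩
      (c ℤ.* c) ℤ.* (w ℤ.* w)  <⟨ ℤP.*-monoˡ-<-pos (c ℤ.* c) {{ℤ.positive (square-pos 0<c)}} w²<D ⟩
      (c ℤ.* c) ℤ.* + D        ≡⟨ ℤP.*-comm (c ℤ.* c) (+ D) ⟩
      + D ℤ.* (c ℤ.* c)        ∎)))
      where
      0<m = ℤP.≰⇒> m≰0

    *⌊√D⌋<⇒*√D< : ∀ {m c} → + 0 ℤ.< c → c ℤ.* (+ 1 ℤ.+ w) ℤ.≤ m → PosZ D m (ℤ.- c)
    *⌊√D⌋<⇒*√D< {m} {c} 0<c c[1+w]≤m = inj₂ (inj₁ (ℤP.<-≤-trans 0<c[1+w] c[1+w]≤m , ℤP.neg-mono-< 0<c , (begin-strict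
      + D ℤ.* (ℤ.- c ℤ.* ℤ.- c)                    ≡⟨ neg-square-comm (+ D) c ⟩
      (c ℤ.* c) ℤ.* + D                            <⟨ ℤP.*-monoˡ-<-pos (c ℤ.* c) {{ℤ.positive (square-pos 0<c)}} D<[1+w]² ⟩
      (c ℤ.* c) ℤ.* ((+ 1 ℤ.+ w) ℤ.* (+ 1 ℤ.+ w))  ≡⟨ square-* c (+ 1 ℤ.+ w) ⟨
      (c ℤ.* (+ 1 ℤ.+ w)) ℤ.* (c ℤ.* (+ 1 ℤ.+ w))  ≤⟨ square-mono-≤ (ℤP.<⇒≤ 0<c[1+w]) c[1+w]≤m ⟩
      m ℤ.* m                                      ∎)))
      where
      0<c[1+w] : + 0 ℤ.< c ℤ.* (+ 1 ℤ.+ w)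
      0<c[1+w] = subst (ℤ._< c ℤ.* (+ 1 ℤ.+ w)) (ℤP.*-zeroʳ c)
        (ℤP.*-monoˡ-<-pos c {{ℤ.positive 0<c}} (ℤP.suc[i]≤j⇒i<j (ℤP.suc-mono 0≤w)))
      neg-square-comm : ∀ d c → d ℤ.* (ℤ.- c ℤ.* ℤ.- c) ≡ (c ℤ.* c) ℤ.* d
      neg-square-comm = solve-∀

  -- For ξ = (P + √D)/Q and w = ⌊√D⌋: WeaklyReduced says ξ > 1 and ξ̄ < 0, Reduced adds ξ̄ > −1.
  record WeaklyReduced (w P Q : ℤ) : Set where
    field
      0<Q   : + 0 ℤ.< Q
      P≤w   : P ℤ.≤ w
      Q-P≤w : Q ℤ.- P ℤ.≤ w

  Reduced : (w P Q : ℤ) → Set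
  Reduced w P Q = WeaklyReduced w P Q × w ℤ.< P ℤ.+ Q

  module _ {w P Q P′ Q′ : ℤ} (k : ℤ) (⌊√D⌋≡w : IsFloorSqrt w) (weak : WeaklyReduced w P Q)
           (P+P′≡kQ : P ℤ.+ P′ ≡ k ℤ.* Q) (P′≤w : P′ ℤ.≤ w) (w<P′+Q : w ℤ.< P′ ℤ.+ Q)
           (Q′Q≡D-P′² : Q′ ℤ.* Q ≡ + D ℤ.- P′ ℤ.* P′) where

    open IsFloorSqrt ⌊√D⌋≡w
    open WeaklyReduced weak
    open ℤP.≤-Reasoning

    Q≤P+P′ : Q ℤ.≤ P ℤ.+ P′
    Q≤P+P′ = begin
      Q              ≡⟨ ℤP.*-identityˡ Q ⟨
      + 1 ℤ.* Q      ≤⟨ ℤP.*-monoʳ-≤-nonNeg Q {{ℤ.nonNegative (ℤP.<⇒≤ 0<Q)}} (ℤP.i<j⇒suc[i]≤j 0<k) ⟩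
      k ℤ.* Q        ≡⟨ P+P′≡kQ ⟨
      P ℤ.+ P′       ∎
      where
      0<kQ : + 0 ℤ.< k ℤ.* Q
      0<kQ = begin-strict
        + 0                     ≡⟨ solve (P ∷ Q ∷ []) ⟩
        Q ℤ.- P ℤ.- (Q ℤ.- P)   ≤⟨ ℤP.+-monoˡ-≤ _ Q-P≤w ⟩
        w ℤ.- (Q ℤ.- P)         <⟨ ℤP.+-monoˡ-< _ w<P′+Q ⟩
        P′ ℤ.+ Q ℤ.- (Q ℤ.- P)  ≡⟨ solve (P ∷ Q ∷ P′ ∷ []) ⟩
        P ℤ.+ P′                ≡⟨ P+P′≡kQ ⟩
        k ℤ.* Q                 ∎
      0<k : + 0 ℤ.< k
      0<k = ℤP.*-cancelʳ-<-nonNeg Q {{ℤ.nonNegative (ℤP.<⇒≤ 0<Q)}} (subst (ℤ._< k ℤ.* Q) (sym (ℤP.*-zeroˡ Q)) 0<kQ)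

    0<P′ : + 0 ℤ.< P′
    0<P′ = ℤP.*-cancelˡ-<-nonNeg (+ 2) (subst (ℤ._< + 2 ℤ.* P′) (sym (ℤP.*-zeroʳ (+ 2))) (begin-strict
      + 0                        ≤⟨ ℤP.i≤j⇒0≤j-i P≤w ⟩
      w ℤ.- P                    <⟨ ℤP.+-monoˡ-< _ w<P′+Q ⟩
      P′ ℤ.+ Q ℤ.- P             ≤⟨ ℤP.+-monoˡ-≤ _ (ℤP.+-monoʳ-≤ P′ Q≤P+P′) ⟩
      P′ ℤ.+ (P ℤ.+ P′) ℤ.- P    ≡⟨ solve (P ∷ P′ ∷ []) ⟩
      + 2 ℤ.* P′                 ∎))

    0<Q′ : + 0 ℤ.< Q′
    0<Q′ = ℤP.*-cancelʳ-<-nonNeg Q {{ℤ.nonNegative (ℤP.<⇒≤ 0<Q)}} (begin-strict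
      + 0 ℤ.* Q                   ≡⟨ solve (Q ∷ P′ ∷ []) ⟩
      P′ ℤ.* P′ ℤ.- P′ ℤ.* P′     ≤⟨ ℤP.+-monoˡ-≤ _ (square-mono-≤ (ℤP.<⇒≤ 0<P′) P′≤w) ⟩
      w ℤ.* w ℤ.- P′ ℤ.* P′       <⟨ ℤP.+-monoˡ-< _ w²<D ⟩
      + D ℤ.- P′ ℤ.* P′           ≡⟨ Q′Q≡D-P′² ⟨
      Q′ ℤ.* Q                    ∎)

    Q′-P′≤w : Q′ ℤ.- P′ ℤ.≤ w
    Q′-P′≤w = ℤP.≮⇒≥ λ w<Q′-P′ →
      let 1+w+P′≤Q′ : (+ 1 ℤ.+ w) ℤ.+ P′ ℤ.≤ Q′
          1+w+P′≤Q′ = begin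
            (+ 1 ℤ.+ w) ℤ.+ P′   ≤⟨ ℤP.+-monoˡ-≤ P′ (ℤP.i<j⇒suc[i]≤j w<Q′-P′) ⟩
            Q′ ℤ.- P′ ℤ.+ P′     ≡⟨ solve (Q′ ∷ P′ ∷ []) ⟩
            Q′                   ∎
          1+w-P′≤Q : (+ 1 ℤ.+ w) ℤ.- P′ ℤ.≤ Q
          1+w-P′≤Q = begin
            (+ 1 ℤ.+ w) ℤ.- P′   ≤⟨ ℤP.+-monoˡ-≤ _ (ℤP.i<j⇒suc[i]≤j w<P′+Q) ⟩
            P′ ℤ.+ Q ℤ.- P′      ≡⟨ solve (Q ∷ P′ ∷ []) ⟩
            Q                    ∎
          0≤1+w+P′ : + 0 ℤ.≤ (+ 1 ℤ.+ w) ℤ.+ P′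
          0≤1+w+P′ = ℤP.+-mono-≤ (ℤP.≤-trans 0≤w (ℤP.i≤suc[i] w)) (ℤP.<⇒≤ 0<P′)
      in begin-contradiction
        (+ 1 ℤ.+ w) ℤ.* (+ 1 ℤ.+ w) ℤ.- P′ ℤ.* P′      ≡⟨ solve (w ∷ P′ ∷ []) ⟩
        ((+ 1 ℤ.+ w) ℤ.+ P′) ℤ.* ((+ 1 ℤ.+ w) ℤ.- P′)  ≤⟨ *-mono-≤-nonNeg 0≤1+w+P′ (ℤP.<⇒≤ 0<Q) 1+w+P′≤Q′ 1+w-P′≤Q ⟩
        Q′ ℤ.* Q                                       ≡⟨ Q′Q≡D-P′² ⟩
        + D ℤ.- P′ ℤ.* P′                              <⟨ ℤP.+-monoˡ-< _ D<[1+w]² ⟩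
        (+ 1 ℤ.+ w) ℤ.* (+ 1 ℤ.+ w) ℤ.- P′ ℤ.* P′      ∎

    w<P′+Q′ : w ℤ.< P′ ℤ.+ Q′
    w<P′+Q′ = ℤP.≰⇒> λ P′+Q′≤w →
      let Q′≤w-P′ : Q′ ℤ.≤ w ℤ.- P′
          Q′≤w-P′ = begin
            Q′                   ≡⟨ solve (Q′ ∷ P′ ∷ []) ⟩
            P′ ℤ.+ Q′ ℤ.- P′     ≤⟨ ℤP.+-monoˡ-≤ _ P′+Q′≤w ⟩
            w ℤ.- P′             ∎
          Q≤w+P′ : Q ℤ.≤ w ℤ.+ P′
          Q≤w+P′ = ℤP.≤-trans Q≤P+P′ (ℤP.+-monoˡ-≤ P′ P≤w)
          0≤w+P′ : + 0 ℤ.≤ w ℤ.+ P′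
          0≤w+P′ = ℤP.+-mono-≤ 0≤w (ℤP.<⇒≤ 0<P′)
      in begin-contradiction
        Q′ ℤ.* Q                     ≤⟨ *-mono-≤-nonNeg (ℤP.<⇒≤ 0<Q′) 0≤w+P′ Q′≤w-P′ Q≤w+P′ ⟩
        (w ℤ.- P′) ℤ.* (w ℤ.+ P′)    ≡⟨ solve (w ∷ P′ ∷ []) ⟩
        w ℤ.* w ℤ.- P′ ℤ.* P′        <⟨ ℤP.+-monoˡ-< _ w²<D ⟩
        + D ℤ.- P′ ℤ.* P′            ≡⟨ Q′Q≡D-P′² ⟨
        Q′ ℤ.* Q                     ∎

    reduced-step : Reduced w P′ Q′
    reduced-step = record { 0<Q = 0<Q′ ; P≤w = P′≤w ; Q-P≤w = Q′-P′≤w } , w<P′+Q′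

  partialQuotient-bounds : ∀ {w P Q P′} k → Reduced w P Q →
    P ℤ.+ P′ ≡ k ℤ.* Q → P′ ℤ.≤ w → w ℤ.< P′ ℤ.+ Q →
    + 4 ℤ.* (+ 1 ℤ.+ w) ℤ.≤ Q ℤ.* (+ 2 ℤ.* k ℤ.+ + 5) × Q ℤ.* (+ 2 ℤ.* k ℤ.- + 1) ℤ.≤ + 4 ℤ.* w
  partialQuotient-bounds {w} {P} {Q} {P′} k (weak , w<P+Q) P+P′≡kQ P′≤w w<P′+Q =
    (begin
      + 4 ℤ.* (+ 1 ℤ.+ w)                                  ≡⟨ solve (w ∷ []) ⟩
      + 2 ℤ.* (+ 1 ℤ.+ w) ℤ.+ + 2 ℤ.* (+ 1 ℤ.+ w) ℤ.+ + 0  ≤⟨ ℤP.+-mono-≤ (ℤP.+-mono-≤ (twice (ℤP.i<j⇒suc[i]≤j w<P′+Q))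
                                                                                 (twice (ℤP.i<j⇒suc[i]≤j w<P+Q)))
                                                                  (ℤP.<⇒≤ 0<Q) ⟩
      + 2 ℤ.* (P′ ℤ.+ Q) ℤ.+ + 2 ℤ.* (P ℤ.+ Q) ℤ.+ Q        ≡⟨ solve (P ∷ P′ ∷ Q ∷ []) ⟩
      + 2 ℤ.* (P ℤ.+ P′) ℤ.+ + 5 ℤ.* Q                      ≡⟨ cong (λ t → + 2 ℤ.* t ℤ.+ + 5 ℤ.* Q) P+P′≡kQ ⟩
      + 2 ℤ.* (k ℤ.* Q) ℤ.+ + 5 ℤ.* Q                       ≡⟨ solve (k ∷ Q ∷ []) ⟩
      Q ℤ.* (+ 2 ℤ.* k ℤ.+ + 5)                             ∎) ,
    (begin
      Q ℤ.* (+ 2 ℤ.* k ℤ.- + 1)   ≡⟨ solve (k ∷ Q ∷ []) ⟩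
      + 2 ℤ.* (k ℤ.* Q) ℤ.- Q     ≡⟨ cong (λ t → + 2 ℤ.* t ℤ.- Q) P+P′≡kQ ⟨
      + 2 ℤ.* (P ℤ.+ P′) ℤ.- Q    ≤⟨ ℤP.+-mono-≤ (twice (ℤP.+-mono-≤ P≤w P′≤w)) (ℤP.neg-mono-≤ (ℤP.<⇒≤ 0<Q)) ⟩
      + 2 ℤ.* (w ℤ.+ w) ℤ.- + 0   ≡⟨ solve (w ∷ []) ⟩
      + 4 ℤ.* w                   ∎)
    where
    open WeaklyReduced weak
    open ℤP.≤-Reasoning
    twice : ∀ {a b} → a ℤ.≤ b → + 2 ℤ.* a ℤ.≤ + 2 ℤ.* b
    twice = ℤP.*-monoˡ-≤-nonNeg (+ 2)

ℚ-*-cancelʳ : ∀ {x y q} → 0ℚ ℚ.< q → x ℚ.* q ≡ y ℚ.* q → x ≡ y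
ℚ-*-cancelʳ {q = q} 0<q xq≡yq = ℚP.≤-antisym (cancel (ℚP.≤-reflexive xq≡yq)) (cancel (ℚP.≤-reflexive (sym xq≡yq)))
  where
  cancel : ∀ {x y} → x ℚ.* q ℚ.≤ y ℚ.* q → x ℚ.≤ y
  cancel = ℚP.*-cancelʳ-≤-pos q {{ℚ.positive 0<q}}

-- In ℚ(√d): the inverse of (√d − p′)/q is (p′ + √d)/q′ when q q′ = d − p′².
inverse-of-surd : ∀ {d a′ b′ c e p′ q q′} → 0ℚ ℚ.< q →
  c ℚ.* q ≡ ℚ.- p′ → e ℚ.* q ≡ 1ℚ → q′ ℚ.* q ≡ d ℚ.- p′ ℚ.* p′ →
  a′ ℚ.* c ℚ.+ d ℚ.* (b′ ℚ.* e) ≡ 1ℚ → a′ ℚ.* e ℚ.+ b′ ℚ.* c ≡ 0ℚ →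
  a′ ℚ.* q′ ≡ p′ × b′ ℚ.* q′ ≡ 1ℚ
inverse-of-surd {d} {a′} {b′} {c} {e} {p′} {q} {q′} 0<q cq≡-p′ eq≡1 q′q≡d-p′² re≡1 im≡0 = a′q′≡p′ , b′q′≡1
  where
  a′≡b′p′ : a′ ≡ b′ ℚ.* p′
  a′≡b′p′ = begin
    a′                                             ≡⟨ Ring.solve (a′ ∷ b′ ∷ p′ ∷ []) ℚ-ring ⟩
    a′ ℚ.* 1ℚ ℚ.+ b′ ℚ.* ℚ.- p′ ℚ.+ b′ ℚ.* p′       ≡⟨ cong₂ (λ s t → a′ ℚ.* s ℚ.+ b′ ℚ.* t ℚ.+ b′ ℚ.* p′) eq≡1 cq≡-p′ ⟨
    a′ ℚ.* (e ℚ.* q) ℚ.+ b′ ℚ.* (c ℚ.* q) ℚ.+ b′ ℚ.* p′  ≡⟨ Ring.solve (a′ ∷ b′ ∷ c ∷ e ∷ q ∷ p′ ∷ []) ℚ-ring ⟩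
    (a′ ℚ.* e ℚ.+ b′ ℚ.* c) ℚ.* q ℚ.+ b′ ℚ.* p′     ≡⟨ cong (λ t → t ℚ.* q ℚ.+ b′ ℚ.* p′) im≡0 ⟩
    0ℚ ℚ.* q ℚ.+ b′ ℚ.* p′                          ≡⟨ Ring.solve (q ∷ b′ ∷ p′ ∷ []) ℚ-ring ⟩
    b′ ℚ.* p′                                      ∎
    where open ≡-Reasoning
  b′q′≡1 : b′ ℚ.* q′ ≡ 1ℚ
  b′q′≡1 = ℚ-*-cancelʳ 0<q (begin
    b′ ℚ.* q′ ℚ.* q                                 ≡⟨ ℚP.*-assoc b′ q′ q ⟩
    b′ ℚ.* (q′ ℚ.* q)                               ≡⟨ cong (b′ ℚ.*_) q′q≡d-p′² ⟩
    b′ ℚ.* (d ℚ.- p′ ℚ.* p′)                        ≡⟨ Ring.solve (b′ ∷ d ∷ p′ ∷ []) ℚ-ring ⟩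
    (b′ ℚ.* p′) ℚ.* ℚ.- p′ ℚ.+ d ℚ.* (b′ ℚ.* 1ℚ)     ≡⟨ cong₂ (λ s t → s ℚ.* ℚ.- p′ ℚ.+ d ℚ.* (b′ ℚ.* t)) a′≡b′p′ eq≡1 ⟨
    a′ ℚ.* ℚ.- p′ ℚ.+ d ℚ.* (b′ ℚ.* (e ℚ.* q))       ≡⟨ cong (λ t → a′ ℚ.* t ℚ.+ d ℚ.* (b′ ℚ.* (e ℚ.* q))) cq≡-p′ ⟨
    a′ ℚ.* (c ℚ.* q) ℚ.+ d ℚ.* (b′ ℚ.* (e ℚ.* q))    ≡⟨ Ring.solve (a′ ∷ b′ ∷ c ∷ e ∷ q ∷ d ∷ []) ℚ-ring ⟩
    (a′ ℚ.* c ℚ.+ d ℚ.* (b′ ℚ.* e)) ℚ.* q           ≡⟨ cong (ℚ._* q) re≡1 ⟩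
    1ℚ ℚ.* q                                        ∎)
    where open ≡-Reasoning
  a′q′≡p′ : a′ ℚ.* q′ ≡ p′
  a′q′≡p′ = begin
    a′ ℚ.* q′               ≡⟨ cong (ℚ._* q′) a′≡b′p′ ⟩
    b′ ℚ.* p′ ℚ.* q′        ≡⟨ Ring.solve (b′ ∷ p′ ∷ q′ ∷ []) ℚ-ring ⟩
    b′ ℚ.* q′ ℚ.* p′        ≡⟨ cong (ℚ._* p′) b′q′≡1 ⟩
    1ℚ ℚ.* p′               ≡⟨ ℚP.*-identityˡ p′ ⟩
    p′                      ∎
    where open ≡-Reasoning

IsSurd : QD → ℤ → ℤ → Set
IsSurd (a , b) P Q = a ℚ.* toℚ Q ≡ toℚ P × b ℚ.* toℚ Q ≡ 1ℚ

[m-a]Q≡mQ-P : ∀ {a P Q} m → a ℚ.* toℚ Q ≡ toℚ P → (toℚ m ℚ.- a) ℚ.* toℚ Q ≡ toℚ (m ℤ.* Q ℤ.- P)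
[m-a]Q≡mQ-P {a} {P} {Q} m aQ≡P = begin
  (toℚ m ℚ.- a) ℚ.* toℚ Q             ≡⟨ distrib (toℚ m) a (toℚ Q) ⟩
  toℚ m ℚ.* toℚ Q ℚ.- a ℚ.* toℚ Q     ≡⟨ cong₂ ℚ._-_ (toℚ-* m Q) aQ≡P ⟩
  toℚ (m ℤ.* Q) ℚ.- toℚ P             ≡⟨ toℚ-minus (m ℤ.* Q) P ⟩
  toℚ (m ℤ.* Q ℤ.- P)                 ∎
  where
  open ≡-Reasoning
  distrib : ∀ x y z → (x ℚ.- y) ℚ.* z ≡ x ℚ.* z ℚ.- y ℚ.* z
  distrib = Ring.solve-∀ ℚ-ring

[a-m]Q≡-[mQ-P] : ∀ {a P Q} m → a ℚ.* toℚ Q ≡ toℚ P → (a ℚ.- toℚ m) ℚ.* toℚ Q ≡ ℚ.- toℚ (m ℤ.* Q ℤ.- P)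
[a-m]Q≡-[mQ-P] {a} {P} {Q} m aQ≡P = trans (flip a (toℚ m) (toℚ Q)) (cong ℚ.-_ ([m-a]Q≡mQ-P m aQ≡P))
  where
  flip : ∀ x y z → (x ℚ.- y) ℚ.* z ≡ ℚ.- ((y ℚ.- x) ℚ.* z)
  flip = Ring.solve-∀ ℚ-ring

module _ (D : ℕ) where

  PosD⇒PosZ-scaled : ∀ {c e A B Q} → + 0 ℤ.< Q → c ℚ.* toℚ Q ≡ toℚ A → e ℚ.* toℚ Q ≡ toℚ B →
    PosD D (c , e) → PosZ D A B
  PosD⇒PosZ-scaled 0<Q cQ≡A eQ≡B pos =
    PosD⇒PosZ D (subst₂ (λ s t → PosD D (s , t)) cQ≡A eQ≡B (PosD-*-pos D (toℚ-mono-< 0<Q) pos))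

  PosZ⇒PosD-scaled : ∀ {A B c e r} → 0ℚ ℚ.< r → toℚ A ℚ.* r ≡ c → toℚ B ℚ.* r ≡ e →
    PosZ D A B → PosD D (c , e)
  PosZ⇒PosD-scaled 0<r Ar≡c Br≡e pos =
    subst₂ (λ s t → PosD D (s , t)) Ar≡c Br≡e (PosD-*-pos D 0<r (PosZ⇒PosD D pos))

  surd-floor : ∀ {x P Q} k → IsSurd x P Q → + 0 ℤ.< Q → IsFloor D x k →
    PosZ D (ℤ.- (+ k ℤ.* Q ℤ.- P)) (+ 1) × PosZ D (+ k ℤ.* Q ℤ.- P ℤ.+ Q) (ℤ.- + 1)
  surd-floor {a , b} {P} {Q} k (aQ≡P , bQ≡1) 0<Q (k≤x , x<1+k) = lower k≤x , upper
    where
    lower : NonNegD D (a ℚ.- toℚ (+ k) , b ℚ.- 0ℚ) → PosZ D (ℤ.- (+ k ℤ.* Q ℤ.- P)) (+ 1)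
    lower (inj₁ pos) = PosD⇒PosZ-scaled 0<Q
      (trans ([a-m]Q≡-[mQ-P] {a} {P} {Q} (+ k) aQ≡P) (toℚ-neg (+ k ℤ.* Q ℤ.- P)))
      (trans (cong (ℚ._* toℚ Q) (ℚP.+-identityʳ b)) bQ≡1)
      pos
    lower (inj₂ (_ , b≡0)) = contradiction 1≡0 λ ()
      where
      open ≡-Reasoning
      1≡0 : 1ℚ ≡ 0ℚ
      1≡0 = begin
        1ℚ             ≡⟨ bQ≡1 ⟨
        b ℚ.* toℚ Q    ≡⟨ cong (ℚ._* toℚ Q) (trans (sym (ℚP.+-identityʳ b)) b≡0) ⟩
        0ℚ ℚ.* toℚ Q   ≡⟨ ℚP.*-zeroˡ (toℚ Q) ⟩
        0ℚ             ∎
    upper : PosZ D (+ k ℤ.* Q ℤ.- P ℤ.+ Q) (ℤ.- + 1)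
    upper = PosD⇒PosZ-scaled 0<Q
      (trans ([m-a]Q≡mQ-P {a} {P} {Q} (+ 1 ℤ.+ + k) aQ≡P) (cong toℚ (shift (+ k) Q P)))
      (trans (negate b (toℚ Q)) (cong ℚ.-_ bQ≡1))
      x<1+k
      where
      shift : ∀ k Q P → (+ 1 ℤ.+ k) ℤ.* Q ℤ.- P ≡ k ℤ.* Q ℤ.- P ℤ.+ Q
      shift = solve-∀
      negate : ∀ b q → (0ℚ ℚ.- b) ℚ.* q ≡ ℚ.- (b ℚ.* q)
      negate = Ring.solve-∀ ℚ-ring

  surd-step : ∀ {x x′ P Q Q′} k → IsSurd x P Q → + 0 ℤ.< Q →
    Q′ ℤ.* Q ≡ + D ℤ.- (+ k ℤ.* Q ℤ.- P) ℤ.* (+ k ℤ.* Q ℤ.- P) →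
    mulD D x′ (subD D x (fromℕD D k)) ≡ (1ℚ , 0ℚ) → IsSurd x′ (+ k ℤ.* Q ℤ.- P) Q′
  surd-step {a , b} {a′ , b′} {P} {Q} {Q′} k (aQ≡P , bQ≡1) 0<Q Q′Q≡D-P′² x′[x-k]≡1 =
    inverse-of-surd {Dℚ D} {a′} {b′} {a ℚ.- toℚ (+ k)} {b ℚ.- 0ℚ} {toℚ P′} {toℚ Q} {toℚ Q′} (toℚ-mono-< 0<Q)
      ([a-m]Q≡-[mQ-P] {a} {P} {Q} (+ k) aQ≡P)
      (trans (cong (ℚ._* toℚ Q) (ℚP.+-identityʳ b)) bQ≡1)
      q′q≡d-p′²
      (cong proj₁ x′[x-k]≡1) (cong proj₂ x′[x-k]≡1)
    where
    P′ = + k ℤ.* Q ℤ.- P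
    q′q≡d-p′² : toℚ Q′ ℚ.* toℚ Q ≡ Dℚ D ℚ.- toℚ P′ ℚ.* toℚ P′
    q′q≡d-p′² = begin
      toℚ Q′ ℚ.* toℚ Q                ≡⟨ toℚ-* Q′ Q ⟩
      toℚ (Q′ ℤ.* Q)                  ≡⟨ cong toℚ Q′Q≡D-P′² ⟩
      toℚ (+ D ℤ.- P′ ℤ.* P′)         ≡⟨ toℚ-minus (+ D) (P′ ℤ.* P′) ⟨
      Dℚ D ℚ.- toℚ (P′ ℤ.* P′)        ≡⟨ cong (λ t → Dℚ D ℚ.- t) (toℚ-* P′ P′) ⟨
      Dℚ D ℚ.- toℚ P′ ℚ.* toℚ P′      ∎
      where open ≡-Reasoning

nextPQ : ℤ → ℤ × ℤ × ℤ → ℤ × ℤ × ℤ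
nextPQ k (P , Q , Q₋) = k ℤ.* Q ℤ.- P , Q₋ ℤ.+ k ℤ.* (P ℤ.- (k ℤ.* Q ℤ.- P)) , Q

module _ (D : ℕ) (u : ℕ → ℕ) where

  -- PQ j = (P j , Q j , Q (j − 1)) where x j = (P j + √D)/Q j and Q (−1) = D.
  PQ : ℕ → ℤ × ℤ × ℤ
  PQ zero = + 0 , + 1 , + D
  PQ (suc j) = nextPQ (+ u j) (PQ j)

  P Q Q₋ : ℕ → ℤ
  P j = proj₁ (PQ j)
  Q j = proj₁ (proj₂ (PQ j))
  Q₋ j = proj₂ (proj₂ (PQ j))

  Q*Q₋≡D-P² : ∀ j → Q j ℤ.* Q₋ j ≡ + D ℤ.- P j ℤ.* P j
  Q*Q₋≡D-P² zero = trans (ℤP.*-identityˡ (+ D)) (sym (ℤP.+-identityʳ (+ D)))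
  Q*Q₋≡D-P² (suc j) = begin
    (Q₋ j ℤ.+ k ℤ.* (P j ℤ.- P′)) ℤ.* Q j         ≡⟨ expand (Q₋ j) k (P j) (Q j) ⟩
    Q j ℤ.* Q₋ j ℤ.+ k ℤ.* Q j ℤ.* (P j ℤ.- P′)   ≡⟨ cong (ℤ._+ k ℤ.* Q j ℤ.* (P j ℤ.- P′)) (Q*Q₋≡D-P² j) ⟩
    + D ℤ.- P j ℤ.* P j ℤ.+ k ℤ.* Q j ℤ.* (P j ℤ.- P′) ≡⟨ complete-square (+ D) k (P j) (Q j) ⟩
    + D ℤ.- P′ ℤ.* P′                            ∎
    where
    open ≡-Reasoning
    k = + u j
    P′ = k ℤ.* Q j ℤ.- P j
    expand : ∀ Q₋ k P Q → (Q₋ ℤ.+ k ℤ.* (P ℤ.- (k ℤ.* Q ℤ.- P))) ℤ.* Q ≡ Q ℤ.* Q₋ ℤ.+ k ℤ.* Q ℤ.* (P ℤ.- (k ℤ.* Q ℤ.- P))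
    expand = solve-∀
    complete-square : ∀ D k P Q → D ℤ.- P ℤ.* P ℤ.+ k ℤ.* Q ℤ.* (P ℤ.- (k ℤ.* Q ℤ.- P)) ≡ D ℤ.- (k ℤ.* Q ℤ.- P) ℤ.* (k ℤ.* Q ℤ.- P)
    complete-square = solve-∀

normForm : ℕ → ℤ → ℤ → ℤ → ℤ → ℤ
normForm D a b c d = a ℤ.* c ℤ.- + D ℤ.* (b ℤ.* d)

normForm-linear : ∀ D k a b c d →
  normForm D (k ℤ.* a ℤ.+ c) (k ℤ.* b ℤ.+ d) a b ≡ k ℤ.* normForm D a b a b ℤ.+ normForm D a b c d
normForm-linear D = expand (+ D)
  where
  expand : ∀ D k a b c d →
    (k ℤ.* a ℤ.+ c) ℤ.* a ℤ.- D ℤ.* ((k ℤ.* b ℤ.+ d) ℤ.* b)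
      ≡ k ℤ.* (a ℤ.* a ℤ.- D ℤ.* (b ℤ.* b)) ℤ.+ (a ℤ.* c ℤ.- D ℤ.* (b ℤ.* d))
  expand = solve-∀

normForm-square : ∀ D k a b c d →
  normForm D (k ℤ.* a ℤ.+ c) (k ℤ.* b ℤ.+ d) (k ℤ.* a ℤ.+ c) (k ℤ.* b ℤ.+ d)
    ≡ k ℤ.* k ℤ.* normForm D a b a b ℤ.+ (k ℤ.+ k) ℤ.* normForm D a b c d ℤ.+ normForm D c d c d
normForm-square D = expand (+ D)
  where
  expand : ∀ D k a b c d →
    (k ℤ.* a ℤ.+ c) ℤ.* (k ℤ.* a ℤ.+ c) ℤ.- D ℤ.* ((k ℤ.* b ℤ.+ d) ℤ.* (k ℤ.* b ℤ.+ d))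
      ≡ k ℤ.* k ℤ.* (a ℤ.* a ℤ.- D ℤ.* (b ℤ.* b)) ℤ.+ (k ℤ.+ k) ℤ.* (a ℤ.* c ℤ.- D ℤ.* (b ℤ.* d))
        ℤ.+ (c ℤ.* c ℤ.- D ℤ.* (d ℤ.* d))
  expand = solve-∀

σ : ℕ → ℤ
σ zero = ℤ.- + 1
σ (suc i) = ℤ.- σ i

∣σ∣≡1 : ∀ i → ℤ.∣ σ i ∣ ≡ 1
∣σ∣≡1 zero = refl
∣σ∣≡1 (suc i) = trans (ℤP.∣-i∣≡∣i∣ (σ i)) (∣σ∣≡1 i)

module _ (D : ℕ) (u : ℕ → ℕ) where

  p₋ q₋ : ℕ → ℤ
  p₋ i = proj₂ (proj₁ (pq u i))
  q₋ i = proj₂ (proj₂ (pq u i))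

  convergent-norms : ∀ i →
      normForm D (p u i) (q u i) (p u i) (q u i) ≡ σ i ℤ.* Q D u (suc i)
    × normForm D (p u i) (q u i) (p₋ i) (q₋ i) ≡ ℤ.- σ i ℤ.* P D u (suc i)
    × normForm D (p₋ i) (q₋ i) (p₋ i) (q₋ i) ≡ ℤ.- σ i ℤ.* Q D u i
  convergent-norms zero = base (+ D) (+ u 0)
    where
    base : ∀ D k →
        k ℤ.* k ℤ.- D ℤ.* (+ 1 ℤ.* + 1) ≡ ℤ.- + 1 ℤ.* (D ℤ.+ k ℤ.* (+ 0 ℤ.- (k ℤ.* + 1 ℤ.- + 0)))
      × k ℤ.* + 1 ℤ.- D ℤ.* (+ 1 ℤ.* + 0) ≡ ℤ.- (ℤ.- + 1) ℤ.* (k ℤ.* + 1 ℤ.- + 0)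
      × + 1 ℤ.* + 1 ℤ.- D ℤ.* (+ 0 ℤ.* + 0) ≡ ℤ.- (ℤ.- + 1) ℤ.* + 1
    base D k = solve (D ∷ k ∷ []) , solve (D ∷ k ∷ []) , solve (D ∷ [])
  convergent-norms (suc i) with convergent-norms i
  ... | αα , αβ , ββ = αα′ , αβ′ , trans αα (sym (negate-twice (σ i) Q₁))
    where
    open ≡-Reasoning
    k = + u (suc i)
    a = p u i
    b = q u i
    c = p₋ i
    d = q₋ i
    P₁ = P D u (suc i)
    Q₀ = Q D u i
    Q₁ = Q D u (suc i)
    αα′ : normForm D (k ℤ.* a ℤ.+ c) (k ℤ.* b ℤ.+ d) (k ℤ.* a ℤ.+ c) (k ℤ.* b ℤ.+ d)
        ≡ ℤ.- σ i ℤ.* (Q₀ ℤ.+ k ℤ.* (P₁ ℤ.- (k ℤ.* Q₁ ℤ.- P₁)))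
    αα′ = begin
      normForm D (k ℤ.* a ℤ.+ c) (k ℤ.* b ℤ.+ d) (k ℤ.* a ℤ.+ c) (k ℤ.* b ℤ.+ d)
        ≡⟨ normForm-square D k a b c d ⟩
      k ℤ.* k ℤ.* normForm D a b a b ℤ.+ (k ℤ.+ k) ℤ.* normForm D a b c d ℤ.+ normForm D c d c d
        ≡⟨ cong₂ (λ s t → k ℤ.* k ℤ.* s ℤ.+ (k ℤ.+ k) ℤ.* t ℤ.+ normForm D c d c d) αα αβ ⟩
      k ℤ.* k ℤ.* (σ i ℤ.* Q₁) ℤ.+ (k ℤ.+ k) ℤ.* (ℤ.- σ i ℤ.* P₁) ℤ.+ normForm D c d c d
        ≡⟨ cong (λ t → k ℤ.* k ℤ.* (σ i ℤ.* Q₁) ℤ.+ (k ℤ.+ k) ℤ.* (ℤ.- σ i ℤ.* P₁) ℤ.+ t) ββ ⟩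
      k ℤ.* k ℤ.* (σ i ℤ.* Q₁) ℤ.+ (k ℤ.+ k) ℤ.* (ℤ.- σ i ℤ.* P₁) ℤ.+ ℤ.- σ i ℤ.* Q₀
        ≡⟨ collect (σ i) k P₁ Q₀ Q₁ ⟩
      ℤ.- σ i ℤ.* (Q₀ ℤ.+ k ℤ.* (P₁ ℤ.- (k ℤ.* Q₁ ℤ.- P₁)))
        ∎
      where
      collect : ∀ s k P₁ Q₀ Q₁ →
        k ℤ.* k ℤ.* (s ℤ.* Q₁) ℤ.+ (k ℤ.+ k) ℤ.* (ℤ.- s ℤ.* P₁) ℤ.+ ℤ.- s ℤ.* Q₀
          ≡ ℤ.- s ℤ.* (Q₀ ℤ.+ k ℤ.* (P₁ ℤ.- (k ℤ.* Q₁ ℤ.- P₁)))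
      collect = solve-∀
    αβ′ : normForm D (k ℤ.* a ℤ.+ c) (k ℤ.* b ℤ.+ d) a b ≡ ℤ.- (ℤ.- σ i) ℤ.* (k ℤ.* Q₁ ℤ.- P₁)
    αβ′ = begin
      normForm D (k ℤ.* a ℤ.+ c) (k ℤ.* b ℤ.+ d) a b      ≡⟨ normForm-linear D k a b c d ⟩
      k ℤ.* normForm D a b a b ℤ.+ normForm D a b c d     ≡⟨ cong₂ (λ s t → k ℤ.* s ℤ.+ t) αα αβ ⟩
      k ℤ.* (σ i ℤ.* Q₁) ℤ.+ ℤ.- σ i ℤ.* P₁              ≡⟨ collect (σ i) k P₁ Q₁ ⟩
      ℤ.- (ℤ.- σ i) ℤ.* (k ℤ.* Q₁ ℤ.- P₁)                 ∎
      where
      collect : ∀ s k P₁ Q₁ → k ℤ.* (s ℤ.* Q₁) ℤ.+ ℤ.- s ℤ.* P₁ ≡ ℤ.- (ℤ.- s) ℤ.* (k ℤ.* Q₁ ℤ.- P₁)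
      collect = solve-∀
    negate-twice : ∀ s Q → ℤ.- (ℤ.- s) ℤ.* Q ≡ s ℤ.* Q
    negate-twice = solve-∀

module _ (D : ℕ) where

  NormBounds : QD → ℕ → Set
  NormBounds n k =
      _<D_ D (0ℚ , + 2 / 1) (mulD D n ((+ k / 1) ℚ.+ (+ 5 / 2) , 0ℚ))
    × _<D_ D (mulD D n ((+ k / 1) ℚ.- (+ 1 / 2) , 0ℚ)) (0ℚ , + 2 / 1)

  -- Doubled, the two claims read 4√D < Q(2k+5) and Q(2k−1) < 4√D.
  norm-bounds : ∀ {w} Q k → IsFloorSqrt D w →
    + 4 ℤ.* (+ 1 ℤ.+ w) ℤ.≤ Q ℤ.* (+ 2 ℤ.* + k ℤ.+ + 5) → Q ℤ.* (+ 2 ℤ.* + k ℤ.- + 1) ℤ.≤ + 4 ℤ.* w →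
    NormBounds (toℚ Q , 0ℚ) k
  norm-bounds {w} Q k ⌊√D⌋≡w 4[1+w]≤A B≤4w =
    PosZ⇒PosD-scaled D 0<½
      (trans (cong (ℚ._* ½) (toℚ-expand (+ 5))) (upper-re (toℚ Q) (toℚ (+ k)) (Dℚ D)))
      (upper-im (toℚ Q) (+ k / 1 ℚ.+ + 5 / 2))
      (*⌊√D⌋<⇒*√D< D ⌊√D⌋≡w {c = + 4} (ℤ.+<+ (ℕ.s≤s ℕ.z≤n)) 4[1+w]≤A) ,
    PosZ⇒PosD-scaled D 0<½
      (trans (cong (ℚ._* ½) (trans (sym (toℚ-neg (Q ℤ.* (+ 2 ℤ.* + k ℤ.- + 1)))) (cong ℚ.-_ (toℚ-expand (ℤ.- + 1)))))
             (lower-re (toℚ Q) (toℚ (+ k)) (Dℚ D)))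
      (lower-im (toℚ Q) (+ k / 1 ℚ.- + 1 / 2))
      (≤*⌊√D⌋⇒<*√D D ⌊√D⌋≡w {c = + 4} (ℤ.+<+ (ℕ.s≤s ℕ.z≤n)) B≤4w)
    where
    ½ = + 1 / 2
    0<½ : 0ℚ ℚ.< ½
    0<½ = ℚP.positive⁻¹ ½
    toℚ-expand : ∀ c → toℚ (Q ℤ.* (+ 2 ℤ.* + k ℤ.+ c)) ≡ toℚ Q ℚ.* (toℚ (+ 2) ℚ.* toℚ (+ k) ℚ.+ toℚ c)
    toℚ-expand c = sym (trans (cong (toℚ Q ℚ.*_) (trans (cong (ℚ._+ toℚ c) (toℚ-* (+ 2) (+ k))) (toℚ-+ (+ 2 ℤ.* + k) c)))
                              (toℚ-* Q (+ 2 ℤ.* + k ℤ.+ c)))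
    upper-re : ∀ q κ d → q ℚ.* (+ 2 / 1 ℚ.* κ ℚ.+ + 5 / 1) ℚ.* ½ ≡ q ℚ.* (κ ℚ.+ + 5 / 2) ℚ.+ d ℚ.* (0ℚ ℚ.* 0ℚ) ℚ.- 0ℚ
    upper-re = Ring.solve-∀ ℚ-ring
    upper-im : ∀ q c → toℚ (ℤ.- + 4) ℚ.* ½ ≡ q ℚ.* 0ℚ ℚ.+ 0ℚ ℚ.* c ℚ.- + 2 / 1
    upper-im = Ring.solve-∀ ℚ-ring
    lower-re : ∀ q κ d → ℚ.- (q ℚ.* (+ 2 / 1 ℚ.* κ ℚ.+ ℚ.- 1ℚ)) ℚ.* ½ ≡ 0ℚ ℚ.- (q ℚ.* (κ ℚ.- + 1 / 2) ℚ.+ d ℚ.* (0ℚ ℚ.* 0ℚ))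
    lower-re = Ring.solve-∀ ℚ-ring
    lower-im : ∀ q c → toℚ (+ 4) ℚ.* ½ ≡ + 2 / 1 ℚ.- (q ℚ.* 0ℚ ℚ.+ 0ℚ ℚ.* c)
    lower-im = Ring.solve-∀ ℚ-ring

∣Nα∣≡∣Q∣ : ∀ D u i → ℤ.∣ Nα D u i ∣ ≡ ℤ.∣ Q D u (suc i) ∣
∣Nα∣≡∣Q∣ D u i = begin
  ℤ.∣ Nα D u i ∣                       ≡⟨ cong ℤ.∣_∣ (proj₁ (convergent-norms D u i)) ⟩
  ℤ.∣ σ i ℤ.* Q D u (suc i) ∣          ≡⟨ ℤP.abs-* (σ i) (Q D u (suc i)) ⟩
  ℤ.∣ σ i ∣ ℕ.* ℤ.∣ Q D u (suc i) ∣     ≡⟨ cong (ℕ._* ℤ.∣ Q D u (suc i) ∣) (∣σ∣≡1 i) ⟩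
  1 ℕ.* ℤ.∣ Q D u (suc i) ∣            ≡⟨ ℕP.*-identityˡ _ ⟩
  ℤ.∣ Q D u (suc i) ∣                  ∎
  where open ≡-Reasoning

absNα≡Q : ∀ D u i → + 0 ℤ.≤ Q D u (suc i) → absNα D u i ≡ (toℚ (Q D u (suc i)) , 0ℚ)
absNα≡Q D u i 0≤Q = cong (λ n → toℚ n , 0ℚ) (trans (cong +_ (∣Nα∣≡∣Q∣ D u i)) (ℤP.0≤i⇒+∣i∣≡i 0≤Q))

module CompleteQuotients {D : ℕ} (1<D : 1 ℕ.< D) {u : ℕ → ℕ} {x : ℕ → QD}
                         (cf : IsCFExpansionOfSqrt D u x) where

  private
    x₀≡√D = proj₁ cf
    floors = proj₁ (proj₂ cf)
    inverses = proj₂ (proj₂ cf)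
    P+[P′-P]≡P′ : ∀ P P′ → P ℤ.+ (P′ ℤ.- P) ≡ P′
    P+[P′-P]≡P′ = solve-∀

  surd₀ : IsSurd (x 0) (+ 0) (+ 1)
  surd₀ = subst (λ y → IsSurd y (+ 0) (+ 1)) (sym x₀≡√D) (refl , refl)

  ⌊√D⌋≡u₀ : IsFloorSqrt D (+ u 0)
  ⌊√D⌋≡u₀ = record
    { 0≤w      = ℤ.+≤+ ℕ.z≤n
    ; w²<D     = <√D⇒square<D D (ℤ.+<+ (ℕP.<⇒≤ 1<D)) (ℤ.+≤+ ℕ.z≤n)
                   (subst (λ m → PosZ D (ℤ.- m) (+ 1)) (u₀*1-0≡u₀ (+ u 0)) (proj₁ floor₀))
    ; D<[1+w]² = proj₂ (√D<⇒D<square D (subst (λ m → PosZ D m (ℤ.- + 1)) (shift (+ u 0)) (proj₂ floor₀)))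
    }
    where
    floor₀ = surd-floor D {x 0} {+ 0} {+ 1} (u 0) surd₀ (ℤ.+<+ (ℕ.s≤s ℕ.z≤n)) (floors 0)
    u₀*1-0≡u₀ : ∀ w → w ℤ.* + 1 ℤ.- + 0 ≡ w
    u₀*1-0≡u₀ = solve-∀
    shift : ∀ w → w ℤ.* + 1 ℤ.- + 0 ℤ.+ + 1 ≡ + 1 ℤ.+ w
    shift = solve-∀

  partial-quotient : ∀ j → IsSurd (x j) (P D u j) (Q D u j) → + 0 ℤ.< Q D u j →
    P D u (suc j) ℤ.≤ + u 0 × + u 0 ℤ.< P D u (suc j) ℤ.+ Q D u j
  partial-quotient j surd 0<Q =
    <√D⇒≤⌊√D⌋ D ⌊√D⌋≡u₀ (proj₁ floor) , √D<⇒⌊√D⌋< D ⌊√D⌋≡u₀ (proj₂ floor)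
    where floor = surd-floor D {x j} {P D u j} {Q D u j} (u j) surd 0<Q (floors j)

  quotient-step : ∀ j → IsSurd (x j) (P D u j) (Q D u j) × WeaklyReduced D (+ u 0) (P D u j) (Q D u j) →
    IsSurd (x (suc j)) (P D u (suc j)) (Q D u (suc j)) × Reduced D (+ u 0) (P D u (suc j)) (Q D u (suc j))
  quotient-step j (surd , weak) =
    surd-step D {x j} {x (suc j)} {P D u j} {Q D u j} {Q D u (suc j)} (u j) surd 0<Q (Q*Q₋≡D-P² D u (suc j)) (inverses j) ,
    reduced-step D (+ u j) ⌊√D⌋≡u₀ weak (P+[P′-P]≡P′ (P D u j) (+ u j ℤ.* Q D u j))
      (proj₁ floor) (proj₂ floor) (Q*Q₋≡D-P² D u (suc j))
    where
    0<Q = WeaklyReduced.0<Q weak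
    floor = partial-quotient j surd 0<Q

  complete-quotient : ∀ j → IsSurd (x j) (P D u j) (Q D u j) × WeaklyReduced D (+ u 0) (P D u j) (Q D u j)
  complete-quotient zero = surd₀ , record
    { 0<Q = ℤ.+<+ (ℕ.s≤s ℕ.z≤n) ; P≤w = ℤ.+≤+ ℕ.z≤n ; Q-P≤w = 1≤⌊√D⌋ D ⌊√D⌋≡u₀ 1<D }
  complete-quotient (suc j) = map₂ proj₁ (quotient-step j (complete-quotient j))

  reduced : ∀ j → Reduced D (+ u 0) (P D u (suc j)) (Q D u (suc j))
  reduced j = proj₂ (quotient-step j (complete-quotient j))

  0<Q : ∀ i → + 0 ℤ.< Q D u (suc i)
  0<Q i = WeaklyReduced.0<Q (proj₁ (reduced i))

  integer-bounds : ∀ i →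
      + 4 ℤ.* (+ 1 ℤ.+ + u 0) ℤ.≤ Q D u (suc i) ℤ.* (+ 2 ℤ.* + u (suc i) ℤ.+ + 5)
    × Q D u (suc i) ℤ.* (+ 2 ℤ.* + u (suc i) ℤ.- + 1) ℤ.≤ + 4 ℤ.* + u 0
  integer-bounds i =
    partialQuotient-bounds D (+ u (suc i)) (reduced i) (P+[P′-P]≡P′ (P D u (suc i)) (+ u (suc i) ℤ.* Q D u (suc i)))
      (proj₁ floor) (proj₂ floor)
    where floor = partial-quotient (suc i) (proj₁ (complete-quotient (suc i))) (0<Q i)

proposition5 : (D : ℕ) → 1 < D → Squarefree D →
    (u : ℕ → ℕ) (x : ℕ → QD) → IsCFExpansionOfSqrt D u x →
    (i : ℕ) →
      _<D_ D (0ℚ , + 2 / 1) (mulD D (absNα D u i) ((+ u (suc i) / 1) + (+ 5 / 2) , 0ℚ))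
    × _<D_ D (mulD D (absNα D u i) ((+ u (suc i) / 1) - (+ 1 / 2) , 0ℚ)) (0ℚ , + 2 / 1)
proposition5 D 1<D _ u x cf i =
  subst (λ n → NormBounds D n (u (suc i))) (sym (absNα≡Q D u i (ℤP.<⇒≤ (0<Q i))))
    (norm-bounds D (Q D u (suc i)) (u (suc i)) ⌊√D⌋≡u₀ (proj₁ (integer-bounds i)) (proj₂ (integer-bounds i)))
  where open CompleteQuotients 1<D {u} {x} cf
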